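{- In intensional Martin-Löf type theory (without function extensionality or truncations), let $X:\mathcal U$ and let $f:X\to X$ be weakly constant, i.e. suppose given $c:\prod_{x,y:X} f(x)=f(y)$. Then the type of fixed points $\mathrm{fix}(f):\equiv\sum_{x:X} x=f(x)$ is a proposition: any two of its elements are equal.
   Context: Intensional Martin-Löf type theory with a universe $\mathcal U$, $\Sigma$, $\Pi$ and identity types $x=_X y$ with eliminator J only (no UIP / axiom K). -}

{-# OPTIONS --without-K #-}
module Defs where

open import Level using (Level)
open import Data.Product using (Σ)
open import Relation.Binary.PropositionalEquality using (_≡_)

wconst : ∀ {ℓ} {X : Set ℓ} → (X → X) → Set ℓ
wconst {X = X} f = (x y : X) → f x ≡ f y

fix : ∀ {ℓ} {X : Set ℓ} → (X → X) → Set ℓ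
fix {X = X} f = Σ X (λ x → x ≡ f x)

isProp : ∀ {ℓ} → Set ℓ → Set ℓ
isProp A = (a b : A) → a ≡ b

{-# OPTIONS --without-K #-}
-- A weakly constant f sends every path e : x ≡ y to the composite of
-- sym (c z x) and c z y, whatever z is, so cong f is determined by its
-- endpoints.  Given fixed points (x , p) and (y , q), take
-- e := p ∙ (c x x)⁻¹ ∙ c x y ∙ q⁻¹; transporting p along e yields
-- e⁻¹ ∙ p ∙ cong f e = e⁻¹ ∙ p ∙ (c x x)⁻¹ ∙ c x y, which cancels down to q.
module Submission where

open import Defs
open import Data.Product using (_,_)
open import Data.Product.Properties using (Σ-≡,≡→≡)
open import Relation.Binary.PropositionalEquality
open import Relation.Binary.PropositionalEquality.Properties
  using (trans-reflʳ; trans-symˡ)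

module _ {a} {A : Set a} where

  cong-weakly-constant : ∀ {b} {B : Set b} (f : A → B) (c : (x y : A) → f x ≡ f y)
                         (z : A) {x y : A} (e : x ≡ y) →
                         cong f e ≡ trans (sym (c z x)) (c z y)
  cong-weakly-constant f c z {x} refl = sym (trans-symˡ (c z x))

  trans-sym-cancel : {x y u v : A} (p : x ≡ u) (d : u ≡ v) (q : y ≡ v) →
                     trans (sym (trans p (trans d (sym q)))) (trans p d) ≡ q
  trans-sym-cancel refl refl refl = refl

module _ {ℓ} {X : Set ℓ} where

  subst-fix : (f : X → X) {x y : X} (e : x ≡ y) (p : x ≡ f x) →
              subst (λ z → z ≡ f z) e p ≡ trans (sym e) (trans p (cong f e))
  subst-fix f refl p = sym (trans-reflʳ p)

lemma4p1 : ∀ {ℓ} {X : Set ℓ} (f : X → X) → wconst f → isProp (fix f)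
lemma4p1 f c (x , p) (y , q) = Σ-≡,≡→≡ (e , p-along-e≡q)
  where
    open ≡-Reasoning

    d : f x ≡ f y
    d = trans (sym (c x x)) (c x y)
    e : x ≡ y
    e = trans p (trans d (sym q))

    p-along-e≡q : subst (λ z → z ≡ f z) e p ≡ q
    p-along-e≡q = begin
      subst (λ z → z ≡ f z) e p           ≡⟨ subst-fix f e p ⟩
      trans (sym e) (trans p (cong f e))  ≡⟨ cong (λ t → trans (sym e) (trans p t)) (cong-weakly-constant f c x e) ⟩
      trans (sym e) (trans p d)           ≡⟨ trans-sym-cancel p d q ⟩
      q                                   ∎
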